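{- Let $\mathrm{Alg}$ be a deterministic non-adaptive rejection sampling algorithm with queries $L_1,\dots,L_t\subseteq[n]$ and cost $\sum_i|L_i|\le n^2/\log^6 n$. Then with probability at least $1-o(1)$ over $\mathbf G\sim\mathcal G_1$ and the oracle responses, at most $n/\log^4 n$ of the responses $\boldsymbol v_1,\dots,\boldsymbol v_t$ are not $\emptyset$; the same holds with probability at least $1-o(1)$ over $\mathbf G\sim\mathcal G_2$ and the oracle responses.
   Context: $\mathcal G_1$ (resp. $\mathcal G_2$) is the distribution of $K_{\mathbf A}\cup K_{[n]\setminus\mathbf A}$ (resp. the complete bipartite graph $K_{\mathbf A,[n]\setminus\mathbf A}$) for a uniformly random $\mathbf A\subset[n]$ of size $n/2$. For a query $L$, the oracle samples a uniform edge $(\boldsymbol j_1,\boldsymbol j_2)$ of $\mathbf G$ and returns $\boldsymbol v=\{\boldsymbol j_1,\boldsymbol j_2\}\cap L$, independently across queries. -}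

module Defs where

open import Data.Bool using (Bool; true; false; not; _∧_; _∨_; _xor_; if_then_else_)
open import Data.Nat using (ℕ; zero; suc; _+_; _*_; _^_; _≤_; _<_; _≤ᵇ_; _≡ᵇ_)
open import Data.Fin using (Fin)
open import Data.Fin.Properties using (_≟_)
open import Data.Fin.Subset using (Subset; ∣_∣)
open import Data.Vec using (Vec; []; _∷_; lookup)
open import Data.Nat.ListAction using (sum)
open import Data.List using (List; []; _∷_; map; length; filterᵇ; cartesianProduct; allFin; concatMap)
open import Data.Product using (_×_; _,_; Σ; ∃)
open import Relation.Nullary.Decidable using (⌊_⌋)

allVec : (n : ℕ) → List (Vec Bool n)
allVec zero    = [] ∷ []
allVec (suc n) = concatMap (λ v → (false ∷ v) ∷ (true ∷ v) ∷ []) (allVec n)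

subsetsOfSize : (n h : ℕ) → List (Subset n)
subsetsOfSize n h = filterᵇ (λ A → ∣ A ∣ ≡ᵇ h) (allVec n)

tuples : {X : Set} → List X → (t : ℕ) → List (Vec X t)
tuples xs zero    = [] ∷ []
tuples xs (suc t) = concatMap (λ x → map (x ∷_) (tuples xs t)) xs

-- Adjacency in G₁ = K_A ∪ K_{[n]∖A}: distinct vertices on the same side.
adj₁ : {n : ℕ} → Subset n → Fin n → Fin n → Bool
adj₁ A i j = not ⌊ i ≟ j ⌋ ∧ not (lookup A i xor lookup A j)

-- Adjacency in G₂ = K_{A,[n]∖A}: vertices on different sides.
adj₂ : {n : ℕ} → Subset n → Fin n → Fin n → Bool
adj₂ A i j = lookup A i xor lookup A j

-- Edges of a graph as ordered pairs (j₁ , j₂); a uniform ordered pair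
-- induces a uniform (unordered) edge.
edges : {n : ℕ} → (Fin n → Fin n → Bool) → List (Fin n × Fin n)
edges {n} adj = filterᵇ (λ { (i , j) → adj i j }) (cartesianProduct (allFin n) (allFin n))

-- Response v = {j₁,j₂} ∩ L is nonempty.
nonempty : {n : ℕ} → Subset n → Fin n × Fin n → Bool
nonempty L (i , j) = lookup L i ∨ lookup L j

hits : {n t : ℕ} → (Fin t → Subset n) → Vec (Fin n × Fin n) t → ℕ
hits L es = sum (map (λ i → if nonempty (L i) (lookup es i) then 1 else 0) (allFin _))

cost : {n t : ℕ} → (Fin t → Subset n) → ℕ
cost {t = t} L = sum (map (λ i → ∣ L i ∣) (allFin t))

adjOf : Bool → {n : ℕ} → Subset n → Fin n → Fin n → Bool
adjOf true  = adj₁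
adjOf false = adj₂

-- Number of outcomes (A , e₁,…,e_t) of the joint experiment
-- (A uniform among h-subsets of [n], each eᵢ a uniform edge of G_A),
-- with at least k nonempty responses.
countAtLeast : (g : Bool) (n h t : ℕ) → (Fin t → Subset n) → ℕ → ℕ
countAtLeast g n h t L k =
  sum (map (λ A → length (filterᵇ (λ es → k ≤ᵇ hits L es) (tuples (edges (adjOf g A)) t)))
           (subsetsOfSize n h))

countAll : (g : Bool) (n h t : ℕ) → ℕ
countAll g n h t =
  sum (map (λ A → length (tuples (edges (adjOf g A)) t)) (subsetsOfSize n h))

-- C · (log₂ n)^d ≤ M, stated without reals:
-- for every rational r = p/q with C·r^d > M one has log₂ n ≤ r, i.e. n^q ≤ 2^p.
CLogPowLe : (d n C M : ℕ) → Set
CLogPowLe d n C M = (p q : ℕ) → 0 < q → M * q ^ d < C * p ^ d → n ^ q ≤ 2 ^ p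

-- C · (log₂ n)^d > M, stated without reals:
-- some rational r = p/q with C·r^d ≥ M has log₂ n > r, i.e. n^q > 2^p.
CLogPowGt : (d n C M : ℕ) → Set
CLogPowGt d n C M = Σ ℕ λ p → Σ ℕ λ q → 0 < q × M * q ^ d ≤ C * p ^ d × 2 ^ p < n ^ q

module Submission where

-- Per graph G_A, a uniformly random edge meets a query set L with probability at most 2|L|/n,
-- because both G₁ and G₂ are regular and a vertex is an endpoint of a uniform edge with
-- probability 1/n.  By linearity the expected number of nonempty responses is at most
-- 2·cost/n ≤ 2n/log⁶n, and Markov's inequality bounds the probability of more than
-- n/log⁴n of them by 2/log²n, which is below 1/m once log n > 2m.

open import Defs
open import Data.Bool using (Bool; true; false; not; _∧_; _∨_; _xor_; if_then_else_; T)
open import Data.Bool.Properties using (xor-comm; xor-same; not-distribˡ-xor)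
open import Data.Nat
  using (ℕ; zero; suc; _+_; _*_; _^_; _≤_; _<_; _≤ᵇ_; _≡ᵇ_; z≤n; s≤s; _≤?_; NonZero; pred; >-nonZero; ≢-nonZero; ≢-nonZero⁻¹)
open import Data.Nat.Properties hiding (_≟_)
open import Data.Nat.Solver using (module +-*-Solver)
open import Data.Nat.ListAction using (sum)
open import Data.Nat.ListAction.Properties using (sum-++)
open import Data.Fin using (Fin; zero; suc)
open import Data.Fin.Properties using (_≟_)
open import Data.Fin.Subset using (Subset; ∣_∣)
open import Data.Vec using (Vec; []; _∷_; lookup)
open import Data.List
  using (List; []; _∷_; map; length; filterᵇ; cartesianProduct; allFin; concatMap; _++_)
open import Data.List.Properties using (map-tabulate; map-++; map-cong; length-tabulate)
open import Data.List.Relation.Unary.All as All using (All; []; _∷_)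
open import Data.List.Relation.Unary.All.Properties using (all-filter)
open import Data.Product using (Σ; ∃-syntax; _×_; _,_)
open import Data.Empty using (⊥-elim)
open import Relation.Nullary.Decidable using (⌊_⌋; yes; no; T?)
open import Relation.Binary.PropositionalEquality
open import Function using (_∘_)
open import Algebra.Properties.CommutativeSemigroup +-commutativeSemigroup
  using (interchange; x∙yz≈y∙xz)
open +-*-Solver using (solve; _:+_; _:*_; _:^_; _:=_; con)

private variable
  X Y : Set

∑ : List X → (X → ℕ) → ℕ
∑ xs f = sum (map f xs)

syntax ∑ xs (λ x → e) = ∑[ x ∈ xs ] e

𝟙 : Bool → ℕ
𝟙 b = if b then 1 else 0

∑-cong : (xs : List X) {f g : X → ℕ} → (∀ x → f x ≡ g x) → ∑ xs f ≡ ∑ xs g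
∑-cong xs f≗g = cong sum (map-cong f≗g xs)

∑-mono : (xs : List X) {f g : X → ℕ} → (∀ x → f x ≤ g x) → ∑ xs f ≤ ∑ xs g
∑-mono []       f≤g = z≤n
∑-mono (x ∷ xs) f≤g = +-mono-≤ (f≤g x) (∑-mono xs f≤g)

∑-mono-All : {xs : List X} {f g : X → ℕ} → All (λ x → f x ≤ g x) xs → ∑ xs f ≤ ∑ xs g
∑-mono-All []            = z≤n
∑-mono-All (fx≤gx ∷ f≤g) = +-mono-≤ fx≤gx (∑-mono-All f≤g)

∑-distrib-+ : (xs : List X) (f g : X → ℕ) → ∑[ x ∈ xs ] (f x + g x) ≡ ∑ xs f + ∑ xs g
∑-distrib-+ []       f g = refl
∑-distrib-+ (x ∷ xs) f g = begin
  f x + g x + ∑[ y ∈ xs ] (f y + g y)  ≡⟨ cong (f x + g x +_) (∑-distrib-+ xs f g) ⟩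
  f x + g x + (∑ xs f + ∑ xs g)        ≡⟨ interchange (f x) (g x) (∑ xs f) (∑ xs g) ⟩
  f x + ∑ xs f + (g x + ∑ xs g)        ∎
  where open ≡-Reasoning

∑-*ˡ : (xs : List X) (c : ℕ) (f : X → ℕ) → ∑[ x ∈ xs ] (c * f x) ≡ c * ∑ xs f
∑-*ˡ []       c f = sym (*-zeroʳ c)
∑-*ˡ (x ∷ xs) c f = trans (cong (c * f x +_) (∑-*ˡ xs c f)) (sym (*-distribˡ-+ c (f x) (∑ xs f)))

∑-const : (xs : List X) (c : ℕ) → ∑[ _ ∈ xs ] c ≡ c * length xs
∑-const []       c = sym (*-zeroʳ c)
∑-const (x ∷ xs) c = trans (cong (c +_) (∑-const xs c)) (sym (*-suc c (length xs)))

length≡∑1 : (xs : List X) → length xs ≡ ∑[ _ ∈ xs ] 1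
length≡∑1 xs = sym (trans (∑-const xs 1) (*-identityˡ (length xs)))

∑-++ : (xs ys : List X) (f : X → ℕ) → ∑ (xs ++ ys) f ≡ ∑ xs f + ∑ ys f
∑-++ xs ys f rewrite map-++ f xs ys = sum-++ (map f xs) (map f ys)

∑-filterᵇ : (xs : List X) (P : X → Bool) (f : X → ℕ) →
  ∑ (filterᵇ P xs) f ≡ ∑[ x ∈ xs ] (if P x then f x else 0)
∑-filterᵇ []       P f = refl
∑-filterᵇ (x ∷ xs) P f with P x
... | true  = cong (f x +_) (∑-filterᵇ xs P f)
... | false = ∑-filterᵇ xs P f

markov : (xs : List X) (k : ℕ) (f : X → ℕ) → k * length (filterᵇ (λ x → k ≤ᵇ f x) xs) ≤ ∑ xs f
markov []       k f = ≤-reflexive (*-zeroʳ k)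
markov (x ∷ xs) k f with k ≤ᵇ f x in k≤ᵇfx
... | true  = ≤-trans (≤-reflexive (*-suc k _))
                (+-mono-≤ (≤ᵇ⇒≤ k (f x) (subst T (sym k≤ᵇfx) _)) (markov xs k f))
... | false = ≤-trans (markov xs k f) (m≤n+m _ _)

∑-map : (xs : List X) (g : X → Y) (f : Y → ℕ) → ∑ (map g xs) f ≡ ∑ xs (f ∘ g)
∑-map []       g f = refl
∑-map (x ∷ xs) g f = cong (f (g x) +_) (∑-map xs g f)

∑-concatMap : (xs : List X) (g : X → List Y) (f : Y → ℕ) →
  ∑ (concatMap g xs) f ≡ ∑[ x ∈ xs ] ∑ (g x) f
∑-concatMap []       g f = refl
∑-concatMap (x ∷ xs) g f =
  trans (∑-++ (g x) (concatMap g xs) f) (cong (∑ (g x) f +_) (∑-concatMap xs g f))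

∑-cartesianProduct : (xs : List X) (ys : List Y) (f : X × Y → ℕ) →
  ∑ (cartesianProduct xs ys) f ≡ ∑[ x ∈ xs ] ∑[ y ∈ ys ] f (x , y)
∑-cartesianProduct []       ys f = refl
∑-cartesianProduct (x ∷ xs) ys f = trans (∑-++ (map (x ,_) ys) _ f)
  (cong₂ _+_ (∑-map ys (x ,_) f) (∑-cartesianProduct xs ys f))

∑-comm : (xs : List X) (ys : List Y) (f : X → Y → ℕ) →
  ∑[ x ∈ xs ] ∑[ y ∈ ys ] f x y ≡ ∑[ y ∈ ys ] ∑[ x ∈ xs ] f x y
∑-comm []       ys f = sym (∑-const ys 0)
∑-comm (x ∷ xs) ys f = trans (cong (∑ ys (f x) +_) (∑-comm xs ys f))
  (sym (∑-distrib-+ ys (f x) (λ y → ∑[ x′ ∈ xs ] f x′ y)))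

∑-mono-scaled-All : {xs : List X} (U V : ℕ) {f g : X → ℕ} →
  All (λ x → U * f x ≤ V * g x) xs → U * ∑ xs f ≤ V * ∑ xs g
∑-mono-scaled-All {xs = xs} U V {f} {g} Uf≤Vg = begin
  U * ∑ xs f           ≡⟨ ∑-*ˡ xs U f ⟨
  ∑[ x ∈ xs ] (U * f x) ≤⟨ ∑-mono-All Uf≤Vg ⟩
  ∑[ x ∈ xs ] (V * g x) ≡⟨ ∑-*ˡ xs V g ⟩
  V * ∑ xs g           ∎
  where open ≤-Reasoning

∑-allFin-suc : {n : ℕ} (f : Fin (suc n) → ℕ) → ∑ (allFin (suc n)) f ≡ f zero + ∑ (allFin n) (f ∘ suc)
∑-allFin-suc f = cong (λ fs → f zero + sum fs)
  (trans (map-tabulate suc f) (sym (map-tabulate (λ i → i) (f ∘ suc))))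

∑-allFin-const : (n c : ℕ) → ∑[ _ ∈ allFin n ] c ≡ c * n
∑-allFin-const n c = trans (∑-const (allFin n) c) (cong (c *_) (length-tabulate (λ i → i)))

∑-𝟙-lookup : {n : ℕ} (M : Subset n) → ∑[ j ∈ allFin n ] 𝟙 (lookup M j) ≡ ∣ M ∣
∑-𝟙-lookup []      = refl
∑-𝟙-lookup (b ∷ M) rewrite ∑-allFin-suc (λ j → 𝟙 (lookup (b ∷ M) j)) | ∑-𝟙-lookup M with b
... | true  = refl
... | false = refl

∑-𝟙-not-lookup : {n : ℕ} (M : Subset n) → ∑[ j ∈ allFin n ] 𝟙 (not (lookup M j)) + ∣ M ∣ ≡ n
∑-𝟙-not-lookup []      = refl
∑-𝟙-not-lookup (b ∷ M) rewrite ∑-allFin-suc (λ j → 𝟙 (not (lookup (b ∷ M) j))) with b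
... | true  = trans (+-suc _ _) (cong suc (∑-𝟙-not-lookup M))
... | false = cong suc (∑-𝟙-not-lookup M)

⌊suc≟suc⌋ : {n : ℕ} (i j : Fin n) → ⌊ suc i ≟ suc j ⌋ ≡ ⌊ i ≟ j ⌋
⌊suc≟suc⌋ i j with i ≟ j
... | yes _ = refl
... | no  _ = refl

⌊≟⌋-sym : {n : ℕ} (i j : Fin n) → ⌊ i ≟ j ⌋ ≡ ⌊ j ≟ i ⌋
⌊≟⌋-sym i j with i ≟ j | j ≟ i
... | yes _   | yes _   = refl
... | no  _   | no  _   = refl
... | yes i≡j | no  j≢i = ⊥-elim (j≢i (sym i≡j))
... | no  i≢j | yes j≡i = ⊥-elim (i≢j (sym j≡i))

∑-allFin-split : {n : ℕ} (i : Fin n) (f : Fin n → ℕ) →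
  ∑ (allFin n) f ≡ f i + ∑[ j ∈ allFin n ] (if ⌊ i ≟ j ⌋ then 0 else f j)
∑-allFin-split zero f =
  trans (∑-allFin-suc f) (cong (f zero +_) (sym (∑-allFin-suc (λ j → if ⌊ zero ≟ j ⌋ then 0 else f j))))
∑-allFin-split {suc n} (suc i) f = begin
  ∑ (allFin (suc n)) f                                ≡⟨ ∑-allFin-suc f ⟩
  f zero + ∑ (allFin n) (f ∘ suc)                     ≡⟨ cong (f zero +_) (∑-allFin-split i (f ∘ suc)) ⟩
  f zero + (f (suc i) + rest i)                       ≡⟨ x∙yz≈y∙xz (f zero) (f (suc i)) (rest i) ⟩
  f (suc i) + (f zero + rest i)                       ≡⟨ cong (λ r → f (suc i) + (f zero + r)) shift ⟩
  f (suc i) + (f zero + ∑[ j ∈ allFin n ] g (suc j))  ≡⟨ cong (f (suc i) +_) (∑-allFin-suc g) ⟨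
  f (suc i) + ∑ (allFin (suc n)) g                    ∎
  where
  open ≡-Reasoning
  rest : Fin n → ℕ
  rest i = ∑[ j ∈ allFin n ] (if ⌊ i ≟ j ⌋ then 0 else f (suc j))
  g : Fin (suc n) → ℕ
  g j = if ⌊ suc i ≟ j ⌋ then 0 else f j
  shift : rest i ≡ ∑[ j ∈ allFin n ] g (suc j)
  shift = ∑-cong (allFin n) (λ j → cong (λ b → if b then 0 else f (suc j)) (sym (⌊suc≟suc⌋ i j)))

module _ {n : ℕ} where

  Symmetric : (Fin n → Fin n → Bool) → Set
  Symmetric adj = ∀ i j → adj i j ≡ adj j i

  degree : (Fin n → Fin n → Bool) → Fin n → ℕ
  degree adj i = ∑[ j ∈ allFin n ] 𝟙 (adj i j)

  Regular : ℕ → (Fin n → Fin n → Bool) → Set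
  Regular d adj = ∀ i → degree adj i ≡ d

  MeetRateBound : List (Fin n × Fin n) → Set
  MeetRateBound E = ∀ M → n * ∑ E (𝟙 ∘ nonempty M) ≤ 2 * ∣ M ∣ * length E

  ∑-edges : (adj : Fin n → Fin n → Bool) (f : Fin n × Fin n → ℕ) →
    ∑ (edges adj) f ≡ ∑[ i ∈ allFin n ] ∑[ j ∈ allFin n ] (if adj i j then f (i , j) else 0)
  ∑-edges adj f = trans (∑-filterᵇ (cartesianProduct (allFin n) (allFin n)) _ f)
    (∑-cartesianProduct (allFin n) (allFin n) _)

  length-edges : {adj : Fin n → Fin n → Bool} {d : ℕ} → Regular d adj → length (edges adj) ≡ n * d
  length-edges {adj} {d} regular = begin
    length (edges adj)                       ≡⟨ length≡∑1 (edges adj) ⟩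
    ∑[ _ ∈ edges adj ] 1                     ≡⟨ ∑-edges adj (λ _ → 1) ⟩
    ∑[ i ∈ allFin n ] degree adj i           ≡⟨ ∑-cong (allFin n) regular ⟩
    ∑[ _ ∈ allFin n ] d                      ≡⟨ ∑-allFin-const n d ⟩
    d * n                                    ≡⟨ *-comm d n ⟩
    n * d                                    ∎
    where open ≡-Reasoning

  ∑-𝟙-weighted-degree : {adj : Fin n → Fin n → Bool} {d : ℕ} → Regular d adj → (M : Subset n) →
    ∑[ i ∈ allFin n ] (𝟙 (lookup M i) * degree adj i) ≡ d * ∣ M ∣
  ∑-𝟙-weighted-degree {adj} {d} regular M = begin
    ∑[ i ∈ allFin n ] (𝟙 (lookup M i) * degree adj i) ≡⟨ ∑-cong (allFin n) (λ i → cong (𝟙 (lookup M i) *_) (regular i)) ⟩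
    ∑[ i ∈ allFin n ] (𝟙 (lookup M i) * d)            ≡⟨ ∑-cong (allFin n) (λ i → *-comm (𝟙 (lookup M i)) d) ⟩
    ∑[ i ∈ allFin n ] (d * 𝟙 (lookup M i))            ≡⟨ ∑-*ˡ (allFin n) d _ ⟩
    d * ∑[ i ∈ allFin n ] 𝟙 (lookup M i)              ≡⟨ cong (d *_) (∑-𝟙-lookup M) ⟩
    d * ∣ M ∣                                         ∎
    where open ≡-Reasoning

  ∑-edges-meeting : {adj : Fin n → Fin n → Bool} {d : ℕ} → Symmetric adj → Regular d adj →
    (M : Subset n) → ∑ (edges adj) (𝟙 ∘ nonempty M) ≤ d * ∣ M ∣ + d * ∣ M ∣
  ∑-edges-meeting {adj} {d} symmetric regular M = begin
    ∑ (edges adj) (𝟙 ∘ nonempty M)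
      ≡⟨ ∑-edges adj (𝟙 ∘ nonempty M) ⟩
    ∑[ i ∈ allFin n ] ∑[ j ∈ allFin n ] (if adj i j then 𝟙 (lookup M i ∨ lookup M j) else 0)
      ≤⟨ ∑-mono (allFin n) (λ i → ∑-mono (allFin n) (λ j → union-bound (lookup M i) (lookup M j) (adj i j))) ⟩
    ∑[ i ∈ allFin n ] ∑[ j ∈ allFin n ] (m i * e i j + m j * e i j)
      ≡⟨ ∑-cong (allFin n) (λ i → ∑-distrib-+ (allFin n) _ _) ⟩
    ∑[ i ∈ allFin n ] (∑[ j ∈ allFin n ] (m i * e i j) + ∑[ j ∈ allFin n ] (m j * e i j))
      ≡⟨ ∑-distrib-+ (allFin n) _ _ ⟩
    ∑[ i ∈ allFin n ] ∑[ j ∈ allFin n ] (m i * e i j) + ∑[ i ∈ allFin n ] ∑[ j ∈ allFin n ] (m j * e i j)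
      ≡⟨ cong₂ _+_ (weighted e (λ _ _ → refl))
                   (trans (∑-comm (allFin n) (allFin n) (λ i j → m j * e i j))
                          (weighted (λ j i → e i j) (λ i j → cong 𝟙 (symmetric j i)))) ⟩
    d * ∣ M ∣ + d * ∣ M ∣ ∎
    where
    open ≤-Reasoning
    m : Fin n → ℕ
    m i = 𝟙 (lookup M i)
    e : Fin n → Fin n → ℕ
    e i j = 𝟙 (adj i j)
    union-bound : ∀ a b c → (if c then 𝟙 (a ∨ b) else 0) ≤ 𝟙 a * 𝟙 c + 𝟙 b * 𝟙 c
    union-bound true  b     true  = s≤s z≤n
    union-bound false true  true  = s≤s z≤n
    union-bound false false true  = z≤n
    union-bound a     b     false = z≤n
    weighted : (e′ : Fin n → Fin n → ℕ) → (∀ i j → e′ i j ≡ e i j) →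
      ∑[ i ∈ allFin n ] ∑[ j ∈ allFin n ] (m i * e′ i j) ≡ d * ∣ M ∣
    weighted e′ e′≡e = trans
      (∑-cong (allFin n) (λ i → trans (∑-*ˡ (allFin n) (m i) (e′ i)) (cong (m i *_) (∑-cong (allFin n) (e′≡e i)))))
      (∑-𝟙-weighted-degree regular M)

  regular⇒meetRateBound : {adj : Fin n → Fin n → Bool} {d : ℕ} → Symmetric adj → Regular d adj →
    MeetRateBound (edges adj)
  regular⇒meetRateBound {adj} {d} symmetric regular M = begin
    n * ∑ (edges adj) (𝟙 ∘ nonempty M)  ≤⟨ *-monoʳ-≤ n (∑-edges-meeting symmetric regular M) ⟩
    n * (d * ∣ M ∣ + d * ∣ M ∣)         ≡⟨ rearrange n d ∣ M ∣ ⟩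
    2 * ∣ M ∣ * (n * d)                 ≡⟨ cong (2 * ∣ M ∣ *_) (length-edges regular) ⟨
    2 * ∣ M ∣ * length (edges adj)      ∎
    where
    open ≤-Reasoning
    rearrange : ∀ a b c → a * (b * c + b * c) ≡ 2 * c * (a * b)
    rearrange = solve 3 (λ a b c → a :* (b :* c :+ b :* c) := con 2 :* c :* (a :* b)) refl

∑-tuples-suc : (xs : List X) (t : ℕ) (f : Vec X (suc t) → ℕ) →
  ∑ (tuples xs (suc t)) f ≡ ∑[ x ∈ xs ] ∑[ es ∈ tuples xs t ] f (x ∷ es)
∑-tuples-suc xs t f = trans (∑-concatMap xs _ f) (∑-cong xs (λ x → ∑-map (tuples xs t) (x ∷_) f))

length-tuples : (xs : List X) (t : ℕ) → length (tuples xs t) ≡ length xs ^ t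
length-tuples xs zero    = refl
length-tuples xs (suc t) = begin
  length (tuples xs (suc t))                  ≡⟨ length≡∑1 (tuples xs (suc t)) ⟩
  ∑[ _ ∈ tuples xs (suc t) ] 1                ≡⟨ ∑-tuples-suc xs t (λ _ → 1) ⟩
  ∑[ _ ∈ xs ] ∑[ _ ∈ tuples xs t ] 1          ≡⟨ ∑-cong xs (λ _ → sym (length≡∑1 (tuples xs t))) ⟩
  ∑[ _ ∈ xs ] length (tuples xs t)            ≡⟨ ∑-const xs _ ⟩
  length (tuples xs t) * length xs            ≡⟨ cong (_* length xs) (length-tuples xs t) ⟩
  length xs ^ t * length xs                   ≡⟨ *-comm (length xs ^ t) (length xs) ⟩
  length xs ^ suc t                           ∎
  where open ≡-Reasoning

module _ {n : ℕ} where

  hits-∷ : {t : ℕ} (L : Fin (suc t) → Subset n) (x : Fin n × Fin n) (es : Vec (Fin n × Fin n) t) →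
    hits L (x ∷ es) ≡ 𝟙 (nonempty (L zero) x) + hits (L ∘ suc) es
  hits-∷ L x es = ∑-allFin-suc (λ i → 𝟙 (nonempty (L i) (lookup (x ∷ es) i)))

  cost-suc : {t : ℕ} (L : Fin (suc t) → Subset n) → cost L ≡ ∣ L zero ∣ + cost (L ∘ suc)
  cost-suc L = ∑-allFin-suc (λ i → ∣ L i ∣)

  ∑-hits-tuples-suc : (E : List (Fin n × Fin n)) {t : ℕ} (L : Fin (suc t) → Subset n) →
    ∑ (tuples E (suc t)) (hits L)
      ≡ ∑ E (𝟙 ∘ nonempty (L zero)) * length E ^ t + ∑ (tuples E t) (hits (L ∘ suc)) * length E
  ∑-hits-tuples-suc E {t} L = begin
    ∑ (tuples E (suc t)) (hits L)
      ≡⟨ ∑-tuples-suc E t (hits L) ⟩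
    ∑[ x ∈ E ] ∑[ es ∈ Tₜ ] hits L (x ∷ es)
      ≡⟨ ∑-cong E (λ x → ∑-cong Tₜ (hits-∷ L x)) ⟩
    ∑[ x ∈ E ] ∑[ es ∈ Tₜ ] (a x + hits (L ∘ suc) es)
      ≡⟨ ∑-cong E (λ x → ∑-distrib-+ Tₜ (λ _ → a x) (hits (L ∘ suc))) ⟩
    ∑[ x ∈ E ] (∑[ _ ∈ Tₜ ] a x + ∑ Tₜ (hits (L ∘ suc)))
      ≡⟨ ∑-distrib-+ E _ _ ⟩
    ∑[ x ∈ E ] ∑[ _ ∈ Tₜ ] a x + ∑[ _ ∈ E ] ∑ Tₜ (hits (L ∘ suc))
      ≡⟨ cong₂ _+_ (∑-cong E (λ x → trans (∑-const Tₜ (a x)) (cong (a x *_) (length-tuples E t))))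
                   (∑-const E _) ⟩
    ∑[ x ∈ E ] (a x * length E ^ t) + ∑ Tₜ (hits (L ∘ suc)) * length E
      ≡⟨ cong (_+ ∑ Tₜ (hits (L ∘ suc)) * length E)
              (trans (∑-cong E (λ x → *-comm (a x) (length E ^ t)))
                     (trans (∑-*ˡ E (length E ^ t) a) (*-comm (length E ^ t) (∑ E a)))) ⟩
    ∑ E a * length E ^ t + ∑ Tₜ (hits (L ∘ suc)) * length E
      ∎
    where
    open ≡-Reasoning
    Tₜ = tuples E t
    a : Fin n × Fin n → ℕ
    a = 𝟙 ∘ nonempty (L zero)

  ∑-hits-tuples : {E : List (Fin n × Fin n)} → MeetRateBound E → (t : ℕ) (L : Fin t → Subset n) →
    n * ∑ (tuples E t) (hits L) ≤ 2 * cost L * length E ^ t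
  ∑-hits-tuples         bound zero    L = ≤-reflexive (*-zeroʳ n)
  ∑-hits-tuples {E = E} bound (suc t) L = begin
    n * ∑ (tuples E (suc t)) (hits L)
      ≡⟨ cong (n *_) (∑-hits-tuples-suc E L) ⟩
    n * (∑ E a * p + ∑ (tuples E t) (hits (L ∘ suc)) * e)
      ≡⟨ *-distribˡ-+ n _ _ ⟩
    n * (∑ E a * p) + n * (∑ (tuples E t) (hits (L ∘ suc)) * e)
      ≡⟨ cong₂ _+_ (sym (*-assoc n _ p)) (sym (*-assoc n _ e)) ⟩
    n * ∑ E a * p + n * ∑ (tuples E t) (hits (L ∘ suc)) * e
      ≤⟨ +-mono-≤ (*-monoˡ-≤ p (bound (L zero))) (*-monoˡ-≤ e (∑-hits-tuples bound t (L ∘ suc))) ⟩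
    2 * ∣ L zero ∣ * e * p + 2 * cost (L ∘ suc) * p * e
      ≡⟨ collect ∣ L zero ∣ (cost (L ∘ suc)) e p ⟩
    2 * (∣ L zero ∣ + cost (L ∘ suc)) * (e * p)
      ≡⟨ cong (λ c → 2 * c * e ^ suc t) (cost-suc L) ⟨
    2 * cost L * e ^ suc t
      ∎
    where
    open ≤-Reasoning
    a = 𝟙 ∘ nonempty (L zero)
    e = length E
    p = e ^ t
    collect : ∀ l c e p → 2 * l * e * p + 2 * c * p * e ≡ 2 * (l + c) * (e * p)
    collect = solve 4 (λ l c e p → con 2 :* l :* e :* p :+ con 2 :* c :* p :* e
                                  := con 2 :* (l :+ c) :* (e :* p)) refl

  count-hits≥-bound : {E : List (Fin n × Fin n)} → MeetRateBound E → (t : ℕ) (L : Fin t → Subset n) (k : ℕ) →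
    (n * k) * length (filterᵇ (λ es → k ≤ᵇ hits L es) (tuples E t)) ≤ (2 * cost L) * length (tuples E t)
  count-hits≥-bound {E} bound t L k = begin
    (n * k) * length (filterᵇ (λ es → k ≤ᵇ hits L es) (tuples E t))
      ≡⟨ *-assoc n k _ ⟩
    n * (k * length (filterᵇ (λ es → k ≤ᵇ hits L es) (tuples E t)))
      ≤⟨ *-monoʳ-≤ n (markov (tuples E t) k (hits L)) ⟩
    n * ∑ (tuples E t) (hits L)
      ≤⟨ ∑-hits-tuples bound t L ⟩
    2 * cost L * length E ^ t
      ≡⟨ cong (2 * cost L *_) (length-tuples E t) ⟨
    2 * cost L * length (tuples E t)
      ∎
    where open ≤-Reasoning

module _ {h : ℕ} {A : Subset (h + h)} (∣A∣≡h : ∣ A ∣ ≡ h) where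

  ∑-𝟙-xor-lookup : (b : Bool) → ∑[ j ∈ allFin (h + h) ] 𝟙 (b xor lookup A j) ≡ h
  ∑-𝟙-xor-lookup false = trans (∑-𝟙-lookup A) ∣A∣≡h
  ∑-𝟙-xor-lookup true  = +-cancelʳ-≡ h _ h
    (trans (cong (∑[ j ∈ allFin (h + h) ] 𝟙 (not (lookup A j)) +_) (sym ∣A∣≡h)) (∑-𝟙-not-lookup A))

  adj₂-regular : Regular h (adj₂ A)
  adj₂-regular i = ∑-𝟙-xor-lookup (lookup A i)

  adj₁-regular : Regular (pred h) (adj₁ A)
  adj₁-regular i = cong pred (sym (begin
    h                                                                   ≡⟨ ∑-𝟙-xor-lookup (not (lookup A i)) ⟨
    ∑[ j ∈ allFin (h + h) ] 𝟙 (not (lookup A i) xor lookup A j)          ≡⟨ ∑-cong (allFin (h + h)) (λ j → cong 𝟙 (not-distribˡ-xor (lookup A i) (lookup A j))) ⟨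
    ∑[ j ∈ allFin (h + h) ] sameSide j                                  ≡⟨ ∑-allFin-split i sameSide ⟩
    sameSide i + ∑[ j ∈ allFin (h + h) ] (if ⌊ i ≟ j ⌋ then 0 else sameSide j)
                                                                        ≡⟨ cong₂ _+_ (cong (𝟙 ∘ not) (sym (xor-same (lookup A i))))
                                                                                     (∑-cong (allFin (h + h)) 𝟙-adj₁) ⟨
    1 + degree (adj₁ A) i                                               ∎))
    where
    open ≡-Reasoning
    sameSide : Fin (h + h) → ℕ
    sameSide j = 𝟙 (not (lookup A i xor lookup A j))
    𝟙-adj₁ : ∀ j → 𝟙 (adj₁ A i j) ≡ (if ⌊ i ≟ j ⌋ then 0 else sameSide j)
    𝟙-adj₁ j with ⌊ i ≟ j ⌋
    ... | true  = refl
    ... | false = refl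

  adjOf-regular : (g : Bool) → ∃[ d ] Regular d (adjOf g A)
  adjOf-regular true  = pred h , adj₁-regular
  adjOf-regular false = h , adj₂-regular

adjOf-symmetric : (g : Bool) {n : ℕ} (A : Subset n) → Symmetric (adjOf g A)
adjOf-symmetric true  A i j = cong₂ (λ u v → not u ∧ not v) (⌊≟⌋-sym i j) (xor-comm (lookup A i) (lookup A j))
adjOf-symmetric false A i j = xor-comm (lookup A i) (lookup A j)

markov-countAtLeast : (g : Bool) (h t : ℕ) (L : Fin t → Subset (h + h)) (k : ℕ) →
  ((h + h) * k) * countAtLeast g (h + h) h t L k ≤ (2 * cost L) * countAll g (h + h) h t
markov-countAtLeast g h t L k =
  ∑-mono-scaled-All ((h + h) * k) (2 * cost L)
    (All.map countBound (all-filter (T? ∘ λ A → ∣ A ∣ ≡ᵇ h) (allVec (h + h))))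
  where
  countBound : {A : Subset (h + h)} → T (∣ A ∣ ≡ᵇ h) →
    ((h + h) * k) * length (filterᵇ (λ es → k ≤ᵇ hits L es) (tuples (edges (adjOf g A)) t))
      ≤ (2 * cost L) * length (tuples (edges (adjOf g A)) t)
  countBound {A} ∣A∣≡ᵇh with adjOf-regular (≡ᵇ⇒≡ ∣ A ∣ h ∣A∣≡ᵇh) g
  ... | d , regular = count-hits≥-bound (regular⇒meetRateBound (adjOf-symmetric g A) regular) t L k

CLogPowLe⇒≤ : {d n C M p q : ℕ} → CLogPowLe d n C M → 0 < q → 2 ^ p < n ^ q → C * p ^ d ≤ M * q ^ d
CLogPowLe⇒≤ {p = p} {q} logPowLe q>0 2ᵖ<nᵠ = ≮⇒≥ (λ M<C → <⇒≱ 2ᵖ<nᵠ (logPowLe p q q>0 M<C))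

≤-pow-nonZero : {d M C p q : ℕ} .{{_ : NonZero M}} .{{_ : NonZero q}} →
  M * q ^ suc d ≤ C * p ^ suc d → NonZero C × NonZero p
≤-pow-nonZero {d} {M} {C} {p} {q} Mqᵈ≤Cpᵈ = m*n≢0⇒m≢0 C , p≢0
  where
  instance
    qᵈ≢0 : NonZero (q ^ suc d)
    qᵈ≢0 = m^n≢0 q (suc d)
    Mqᵈ≢0 : NonZero (M * q ^ suc d)
    Mqᵈ≢0 = m*n≢0 M (q ^ suc d)
    Cpᵈ≢0 : NonZero (C * p ^ suc d)
    Cpᵈ≢0 = ≢-nonZero (λ Cpᵈ≡0 → ≢-nonZero⁻¹ (M * q ^ suc d)
      (n≤0⇒n≡0 (subst (M * q ^ suc d ≤_) Cpᵈ≡0 Mqᵈ≤Cpᵈ)))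
  p≢0 : NonZero p
  p≢0 = ≢-nonZero (λ { refl → ≢-nonZero⁻¹ (0 ^ suc d) {{m*n≢0⇒n≢0 C}} refl })

-- With r = p/q a lower bound for log n, either r² ≥ 2m and the bound on the cost at r suffices,
-- or r² < 2m, in which case k ≥ n/(4m²) and the cost bound at r = 2m (valid as n > 2^(2m)) suffices.
2mc≤kn : (m n c k : ℕ) .{{_ : NonZero m}} → 2 ^ (2 * m) < n →
  CLogPowLe 6 n c (n * n) → CLogPowGt 4 n k n → 2 * m * c ≤ k * n
2mc≤kn m n c k 4ᵐ<n costLe (p , q , q>0 , nq⁴≤kp⁴ , 2ᵖ<nᵠ) with 2 * m * (q * q) ≤? p * p
... | yes large = *-cancelʳ-≤ (2 * m * c) (k * n) (n * q ^ 6 * p ^ 4) {{nqp≢0}} (begin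
  2 * m * c * (n * q ^ 6 * p ^ 4)        ≡⟨ solve 5 (λ m c n q p → con 2 :* m :* c :* (n :* q :^ 6 :* p :^ 4)
                                                  := c :* (con 2 :* m :* (q :* q)) :* (p :^ 4 :* (n :* q :^ 4))) refl m c n q p ⟩
  c * (2 * m * (q * q)) * (p ^ 4 * (n * q ^ 4)) ≤⟨ *-monoˡ-≤ (p ^ 4 * (n * q ^ 4)) (*-monoʳ-≤ c large) ⟩
  c * (p * p) * (p ^ 4 * (n * q ^ 4))     ≡⟨ solve 4 (λ c p n q → c :* (p :* p) :* (p :^ 4 :* (n :* q :^ 4))
                                                  := c :* p :^ 6 :* (n :* q :^ 4)) refl c p n q ⟩
  c * p ^ 6 * (n * q ^ 4)                ≤⟨ *-mono-≤ (CLogPowLe⇒≤ {6} {n} {c} {n * n} {p} {q} costLe q>0 2ᵖ<nᵠ) nq⁴≤kp⁴ ⟩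
  n * n * q ^ 6 * (k * p ^ 4)            ≡⟨ solve 4 (λ n q k p → n :* n :* q :^ 6 :* (k :* p :^ 4)
                                                  := k :* n :* (n :* q :^ 6 :* p :^ 4)) refl n q k p ⟩
  k * n * (n * q ^ 6 * p ^ 4)            ∎)
  where
  open ≤-Reasoning
  instance
    n≢0 : NonZero n
    n≢0 = >-nonZero (≤-trans (s≤s z≤n) 4ᵐ<n)
    q≢0 : NonZero q
    q≢0 = >-nonZero q>0
  nqp≢0 : NonZero (n * q ^ 6 * p ^ 4)
  nqp≢0 with ≤-pow-nonZero {3} {n} {k} {p} {q} nq⁴≤kp⁴
  ... | _ , p≢0 = m*n≢0 (n * q ^ 6) (p ^ 4) {{nq⁶≢0}} {{m^n≢0 p 4 {{p≢0}}}}
    where nq⁶≢0 = m*n≢0 n (q ^ 6) {{n≢0}} {{m^n≢0 q 6}}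
... | no small = *-cancelʳ-≤ (2 * m * c) (k * n) ((2 * m) ^ 6) {{m^n≢0 (2 * m) 6 {{m*n≢0 2 m}}}} (begin
  2 * m * c * (2 * m) ^ 6                ≡⟨ *-assoc (2 * m) c _ ⟩
  2 * m * (c * (2 * m) ^ 6)              ≤⟨ *-monoʳ-≤ (2 * m) c[2m]⁶≤n² ⟩
  2 * m * (n * n)                        ≤⟨ *-monoʳ-≤ (2 * m) (*-monoʳ-≤ n n≤4m²k) ⟩
  2 * m * (n * (4 * m * m * k))          ≡⟨ solve 3 (λ m n k → con 2 :* m :* (n :* (con 4 :* m :* m :* k))
                                                  := k :* n :* (con 8 :* m :^ 3)) refl m n k ⟩
  k * n * (8 * m ^ 3)                    ≤⟨ m≤m*n (k * n * (8 * m ^ 3)) (8 * m ^ 3) {{8m³≢0}} ⟩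
  k * n * (8 * m ^ 3) * (8 * m ^ 3)      ≡⟨ solve 3 (λ m n k → k :* n :* (con 8 :* m :^ 3) :* (con 8 :* m :^ 3)
                                                  := k :* n :* (con 2 :* m) :^ 6) refl m n k ⟩
  k * n * (2 * m) ^ 6                    ∎)
  where
  open ≤-Reasoning
  8m³≢0 : NonZero (8 * m ^ 3)
  8m³≢0 = m*n≢0 8 (m ^ 3) {{_}} {{m^n≢0 m 3}}
  p²≤2mq² : p * p ≤ 2 * m * (q * q)
  p²≤2mq² = ≰⇒≥ small
  n≤4m²k : n ≤ 4 * m * m * k
  n≤4m²k = *-cancelʳ-≤ n (4 * m * m * k) (q ^ 4) {{m^n≢0 q 4 {{>-nonZero q>0}}}} (begin
    n * q ^ 4                              ≤⟨ nq⁴≤kp⁴ ⟩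
    k * p ^ 4                              ≡⟨ solve 2 (λ k p → k :* p :^ 4 := k :* (p :* p :* (p :* p))) refl k p ⟩
    k * (p * p * (p * p))                  ≤⟨ *-monoʳ-≤ k (*-mono-≤ p²≤2mq² p²≤2mq²) ⟩
    k * (2 * m * (q * q) * (2 * m * (q * q))) ≡⟨ solve 3 (λ k m q → k :* (con 2 :* m :* (q :* q) :* (con 2 :* m :* (q :* q)))
                                                     := con 4 :* m :* m :* k :* q :^ 4) refl k m q ⟩
    4 * m * m * k * q ^ 4                  ∎)
  c[2m]⁶≤n² : c * (2 * m) ^ 6 ≤ n * n
  c[2m]⁶≤n² = subst (c * (2 * m) ^ 6 ≤_) (*-identityʳ (n * n))
    (CLogPowLe⇒≤ {6} {n} {c} {n * n} {2 * m} {1} costLe (s≤s z≤n) (subst (2 ^ (2 * m) <_) (sym (*-identityʳ n)) 4ᵐ<n))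

≤-by-ratio : (m n k c x y : ℕ) .{{_ : NonZero (k * n)}} →
  (n * k) * x ≤ (2 * c) * y → 2 * m * c ≤ k * n → m * x ≤ y
≤-by-ratio m n k c x y nkx≤2cy 2mc≤kn = *-cancelʳ-≤ (m * x) y (k * n) (begin
  m * x * (k * n)    ≡⟨ solve 4 (λ m x k n → m :* x :* (k :* n) := m :* (n :* k :* x)) refl m x k n ⟩
  m * (n * k * x)    ≤⟨ *-monoʳ-≤ m nkx≤2cy ⟩
  m * (2 * c * y)    ≡⟨ solve 3 (λ m c y → m :* (con 2 :* c :* y) := con 2 :* m :* c :* y) refl m c y ⟩
  2 * m * c * y      ≤⟨ *-monoˡ-≤ y 2mc≤kn ⟩
  k * n * y          ≡⟨ *-comm (k * n) y ⟩
  y * (k * n)        ∎)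
  where open ≤-Reasoning

countAtLeast-bound : (m h t : ℕ) (L : Fin t → Subset (h + h)) (k : ℕ) .{{_ : NonZero m}} →
  2 ^ (2 * m) < h + h → CLogPowLe 6 (h + h) (cost L) ((h + h) * (h + h)) →
  CLogPowGt 4 (h + h) k (h + h) → (g : Bool) →
  m * countAtLeast g (h + h) h t L k ≤ countAll g (h + h) h t
countAtLeast-bound m h t L k 4ᵐ<n costLe thresholdGt@(p , q , q>0 , nq⁴≤kp⁴ , _) g =
  ≤-by-ratio m (h + h) k (cost L) _ _ {{kn≢0}}
    (markov-countAtLeast g h t L k) (2mc≤kn m (h + h) (cost L) k 4ᵐ<n costLe thresholdGt)
  where
  instance
    n≢0 : NonZero (h + h)
    n≢0 = >-nonZero (≤-trans (s≤s z≤n) 4ᵐ<n)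
    q≢0 : NonZero q
    q≢0 = >-nonZero q>0
  kn≢0 : NonZero (k * (h + h))
  kn≢0 with ≤-pow-nonZero {3} {h + h} {k} {p} {q} nq⁴≤kp⁴
  ... | k≢0 , _ = m*n≢0 k (h + h) {{k≢0}}

lemma6p14 : (m : ℕ) → 0 < m →
    Σ ℕ λ N → (h : ℕ) → N ≤ h + h →
      (t : ℕ) (L : Fin t → Subset (h + h)) →
      CLogPowLe 6 (h + h) (cost L) ((h + h) * (h + h)) →
      (k : ℕ) → CLogPowGt 4 (h + h) k (h + h) →
      (m * countAtLeast true (h + h) h t L k ≤ countAll true (h + h) h t)
      × (m * countAtLeast false (h + h) h t L k ≤ countAll false (h + h) h t)
lemma6p14 m m>0 = suc (2 ^ (2 * m)) , λ h 4ᵐ<n t L costLe k thresholdGt →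
  let bound = countAtLeast-bound m h t L k {{>-nonZero m>0}} 4ᵐ<n costLe thresholdGt
  in bound true , bound false
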